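{- Work in ZFU. For every set $x$, set $S$ and ordinal $\alpha$, if $x\preceq^* S\times\alpha$ then $x\preceq P(S)\times\alpha$.
   Context: ZFU is ZF-style set theory with urelements (language $\in$ plus a predicate for urelements; Foundation, Pairing, Union, Powerset, Infinity, Separation, Replacement, Extensionality for sets, urelements have no members; no Choice). $x\preceq y$ means there is an injection from $x$ into $y$; $x\preceq^* y$ means there is a surjection from $y$ onto $x$ or $x=\emptyset$. -}

module Defs where

-- Semantic rendering of ZFU: a first-order structure (D, ∈, U) with equality
-- interpreted as Agda's ≡.  Classical logic is obtained via the Gödel–Gentzen
-- negative translation: atoms are assumed ¬¬-stable and ∨ / ∃ are defined
-- negatively, so every notion below is ¬¬-stable (classical).

open import Level using (Level; suc)
open import Data.Nat using (ℕ; zero) renaming (suc to succ)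
open import Data.Product using (_×_; _,_)
open import Data.Empty using (⊥)
open import Relation.Nullary using (¬_)
open import Relation.Binary.PropositionalEquality using (_≡_)

-- First-order formulas over the language {∈, U, =}; variables are de Bruijn indices.
data Fm : Set where
  _∈'_ : ℕ → ℕ → Fm
  U'   : ℕ → Fm
  _≐_  : ℕ → ℕ → Fm
  ⊥'   : Fm
  _⇒_  : Fm → Fm → Fm
  ∀'   : Fm → Fm

record Structure (ℓ : Level) : Set (suc ℓ) where
  field
    D   : Set ℓ
    _∈_ : D → D → Set ℓ
    U   : D → Set ℓ
  infix 4 _∈_

infixr 2 _∨_
infix 1 _⇔_
_∨_ : ∀ {ℓ} → Set ℓ → Set ℓ → Set ℓ
A ∨ B = ¬ (¬ A × ¬ B)

_⇔_ : ∀ {ℓ} → Set ℓ → Set ℓ → Set ℓ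
A ⇔ B = (A → B) × (B → A)

module _ {ℓ : Level} (M : Structure ℓ) where
  open Structure M

  Ex : (D → Set ℓ) → Set ℓ
  Ex P = ¬ (∀ x → ¬ P x)

  _∷ₑ_ : D → (ℕ → D) → (ℕ → D)
  (d ∷ₑ ρ) zero = d
  (d ∷ₑ ρ) (succ n) = ρ n

  Sat : (ℕ → D) → Fm → Set ℓ
  Sat ρ (i ∈' j) = ρ i ∈ ρ j
  Sat ρ (U' i)   = U (ρ i)
  Sat ρ (i ≐ j)  = ρ i ≡ ρ j
  Sat ρ ⊥'       = Level.Lift ℓ ⊥
  Sat ρ (φ ⇒ ψ)  = Sat ρ φ → Sat ρ ψ
  Sat ρ (∀' φ)   = ∀ d → Sat (d ∷ₑ ρ) φ

  IsSet : D → Set ℓ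
  IsSet x = ¬ U x

  infix 4 _⊆_ _≼_ _≼*_
  _⊆_ : D → D → Set ℓ
  x ⊆ y = ∀ z → z ∈ x → z ∈ y

  IsEmpty : D → Set ℓ
  IsEmpty e = IsSet e × (∀ z → ¬ (z ∈ e))

  IsUPair : D → D → D → Set ℓ
  IsUPair p a b = IsSet p × (∀ z → z ∈ p ⇔ ((z ≡ a) ∨ (z ≡ b)))

  IsOPair : D → D → D → Set ℓ
  IsOPair p a b = Ex λ u → Ex λ v → IsUPair u a a × IsUPair v a b × IsUPair p u v

  IsProd : D → D → D → Set ℓ
  IsProd P A B = IsSet P × (∀ p → p ∈ P ⇔ Ex (λ a → Ex (λ b → a ∈ A × b ∈ B × IsOPair p a b)))

  IsPow : D → D → Set ℓ
  IsPow P S = IsSet P × (∀ z → z ∈ P ⇔ (IsSet z × z ⊆ S))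

  IsSucc : D → D → Set ℓ
  IsSucc s y = IsSet s × (∀ z → z ∈ s ⇔ ((z ∈ y) ∨ (z ≡ y)))

  Transitive : D → Set ℓ
  Transitive x = ∀ y z → z ∈ y → y ∈ x → z ∈ x

  -- von Neumann ordinal (in the presence of Foundation): a transitive set of transitive sets
  Ordinal : D → Set ℓ
  Ordinal α = IsSet α × Transitive α × (∀ β → β ∈ α → IsSet β × Transitive β)

  Rel : D → D → D → Set ℓ
  Rel f a b = Ex λ p → p ∈ f × IsOPair p a b

  IsFun : D → D → D → Set ℓ
  IsFun f X Y = IsSet f
              × (∀ p → p ∈ f → Ex (λ a → Ex (λ b → a ∈ X × b ∈ Y × IsOPair p a b)))
              × (∀ a → a ∈ X → Ex (λ b → Rel f a b))
              × (∀ a b b' → Rel f a b → Rel f a b' → b ≡ b')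

  IsInj : D → Set ℓ
  IsInj f = ∀ a a' b → Rel f a b → Rel f a' b → a ≡ a'

  IsSurjOnto : D → D → Set ℓ
  IsSurjOnto f Y = ∀ b → b ∈ Y → Ex (λ a → Rel f a b)

  _≼_ : D → D → Set ℓ
  x ≼ y = Ex λ f → IsFun f x y × IsInj f

  _≼*_ : D → D → Set ℓ
  x ≼* y = (Ex λ f → IsFun f y x × IsSurjOnto f x) ∨ IsEmpty x

  record IsZFU : Set ℓ where
    field
      stable-∈ : ∀ x y → ¬ ¬ (x ∈ y) → x ∈ y
      stable-U : ∀ x → ¬ ¬ (U x) → U x
      stable-≡ : ∀ (x y : D) → ¬ ¬ (x ≡ y) → x ≡ y
      urelements-empty : ∀ x z → U x → ¬ (z ∈ x)
      extensionality : ∀ x y → IsSet x → IsSet y → (∀ z → z ∈ x ⇔ z ∈ y) → x ≡ y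
      foundation : ∀ x → IsSet x → Ex (λ y → y ∈ x)
                   → Ex (λ y → y ∈ x × (∀ z → z ∈ y → ¬ (z ∈ x)))
      pairing : ∀ a b → Ex (λ p → IsUPair p a b)
      union : ∀ x → Ex (λ u → IsSet u × (∀ z → z ∈ u ⇔ Ex (λ y → y ∈ x × z ∈ y)))
      powerset : ∀ x → IsSet x → Ex (λ P → IsPow P x)
      infinity : Ex (λ I → IsSet I × Ex (λ e → IsEmpty e × e ∈ I)
                   × (∀ y → y ∈ I → Ex (λ s → s ∈ I × IsSucc s y)))
      separation : ∀ (φ : Fm) (ρ : ℕ → D) x → IsSet x
                   → Ex (λ b → IsSet b × (∀ z → z ∈ b ⇔ (z ∈ x × Sat (z ∷ₑ ρ) φ)))
      replacement : ∀ (φ : Fm) (ρ : ℕ → D) a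
                   → (∀ x → x ∈ a → Ex (λ y → ∀ y' → Sat (y' ∷ₑ (x ∷ₑ ρ)) φ ⇔ (y' ≡ y)))
                   → Ex (λ b → IsSet b × (∀ x → x ∈ a → Ex (λ y → y ∈ b × Sat (y ∷ₑ (x ∷ₑ ρ)) φ)))

-- Let g be a surjection from S × α onto x. For y ∈ x let β be the least ordinal
-- below α such that y = g(s, β) for some s ∈ S, and let A = {s ∈ S | g(s, β) = y}.
-- Then y ↦ (A, β) is a map x → 𝒫(S) × α, and it is injective because A is
-- nonempty and g is a function. Least elements exist by Foundation, and β is
-- unique because members of an ordinal are comparable; no choice is needed since
-- (A, β) is determined by y, so the map is a set by Replacement.
module Submission where

open import Defs
open import Level using (Level; lift; lower)
open import Data.Nat using (ℕ; zero; suc; _+_)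
open import Data.Product using (_×_; _,_; proj₁; proj₂)
open import Data.Empty using (⊥; ⊥-elim)
open import Function using (id; _∘_; const)
open import Relation.Nullary using (¬_; Stable; negated-stable)
open import Relation.Binary.PropositionalEquality
  using (_≡_; refl; sym; trans; subst; subst₂)

private
  variable
    ℓ₁ ℓ₂ ℓ₃ : Level
    C : Set ℓ₃

⊥-stable : Stable ⊥
⊥-stable ¬¬⊥ = ¬¬⊥ id

Π-stable : {A : Set ℓ₁} {P : A → Set ℓ₂} → (∀ x → Stable (P x)) → Stable (∀ x → P x)
Π-stable sp ¬¬f x = sp x (λ ¬px → ¬¬f (λ f → ¬px (f x)))

module _ {A : Set ℓ₁} {B : Set ℓ₂} where

  ×-stable : Stable A → Stable B → Stable (A × B)
  ×-stable sa sb ¬¬ab = sa (λ ¬a → ¬¬ab (¬a ∘ proj₁)) , sb (λ ¬b → ¬¬ab (¬b ∘ proj₂))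

  →-stable : Stable B → Stable (A → B)
  →-stable sb = Π-stable (const sb)

module _ {A B : Set ℓ₁} where

  ⇔-stable : Stable A → Stable B → Stable (A ⇔ B)
  ⇔-stable sa sb = ×-stable (→-stable sb) (→-stable sa)

  ∨-introˡ : A → A ∨ B
  ∨-introˡ x (¬a , _) = ¬a x

  ∨-introʳ : B → A ∨ B
  ∨-introʳ y (_ , ¬b) = ¬b y

  ∨-elim : Stable C → A ∨ B → (A → C) → (B → C) → C
  ∨-elim sc a∨b ka kb = sc (λ ¬c → a∨b (¬c ∘ ka , ¬c ∘ kb))

infix 25 ¬ᶠ_
infixr 6 _∧ᶠ_

¬ᶠ_ : Fm → Fm
¬ᶠ φ = φ ⇒ ⊥'

_∧ᶠ_ : Fm → Fm → Fm
φ ∧ᶠ ψ = ¬ᶠ (φ ⇒ (¬ᶠ ψ))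

_∨ᶠ_ : Fm → Fm → Fm
φ ∨ᶠ ψ = ¬ᶠ (¬ᶠ φ ∧ᶠ ¬ᶠ ψ)

_⇔ᶠ_ : Fm → Fm → Fm
φ ⇔ᶠ ψ = (φ ⇒ ψ) ∧ᶠ (ψ ⇒ φ)

∃ᶠ : Fm → Fm
∃ᶠ φ = ¬ᶠ (∀' (¬ᶠ φ))

ext : (ℕ → ℕ) → ℕ → ℕ
ext r zero    = zero
ext r (suc i) = suc (r i)

rename : (ℕ → ℕ) → Fm → Fm
rename r (i ∈' j) = r i ∈' r j
rename r (U' i)   = U' (r i)
rename r (i ≐ j)  = r i ≐ r j
rename r ⊥'       = ⊥'
rename r (φ ⇒ ψ)  = rename r φ ⇒ rename r ψ
rename r (∀' φ)   = ∀' (rename (ext r) φ)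

upairᶠ : ℕ → ℕ → ℕ → Fm
upairᶠ p a b = ¬ᶠ U' p ∧ᶠ ∀' ((0 ∈' suc p) ⇔ᶠ ((0 ≐ suc a) ∨ᶠ (0 ≐ suc b)))

opairᶠ : ℕ → ℕ → ℕ → Fm
opairᶠ p a b =
  ∃ᶠ (∃ᶠ (upairᶠ 1 (2 + a) (2 + a) ∧ᶠ upairᶠ 0 (2 + a) (2 + b) ∧ᶠ upairᶠ (2 + p) 1 0))

relᶠ : ℕ → ℕ → ℕ → Fm
relᶠ f a b = ∃ᶠ ((0 ∈' suc f) ∧ᶠ opairᶠ 0 (suc a) (suc b))

module Semantics {ℓ : Level} (M : Structure ℓ) where
  open Structure M

  infixr 5 _∷_
  _∷_ : D → (ℕ → D) → ℕ → D
  _∷_ = _∷ₑ_ M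

  Ex-intro : {P : D → Set ℓ} (d : D) → P d → Ex M P
  Ex-intro d pd ¬P = ¬P d pd

  Ex-elim : {P : D → Set ℓ} → Stable C → Ex M P → (∀ d → P d → C) → C
  Ex-elim sc e k = sc (λ ¬c → e (λ d pd → ¬c (k d pd)))

  -- A record rather than Sat M ρ φ ⇔ P, so that ρ and φ can be inferred.
  record Expresses (ρ : ℕ → D) (φ : Fm) (P : Set ℓ) : Set ℓ where
    constructor expresses
    field
      sound    : Sat M ρ φ → P
      complete : P → Sat M ρ φ
  open Expresses public

  ∈-expr : ∀ ρ i j → Expresses ρ (i ∈' j) (ρ i ∈ ρ j)
  ∈-expr ρ i j = expresses id id

  ≐-expr : ∀ ρ i j → Expresses ρ (i ≐ j) (ρ i ≡ ρ j)
  ≐-expr ρ i j = expresses id id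

  U-expr : ∀ ρ i → Expresses ρ (U' i) (U (ρ i))
  U-expr ρ i = expresses id id

  private
    variable
      ρ : ℕ → D
      φ ψ : Fm
      P Q : Set ℓ

  ⇒-expr : Expresses ρ φ P → Expresses ρ ψ Q → Expresses ρ (φ ⇒ ψ) (P → Q)
  ⇒-expr (expresses φ→ φ←) (expresses ψ→ ψ←) =
    expresses (λ f → ψ→ ∘ f ∘ φ←) (λ f → ψ← ∘ f ∘ φ→)

  ¬-expr : Expresses ρ φ P → Expresses ρ (¬ᶠ φ) (¬ P)
  ¬-expr (expresses φ→ φ←) = expresses (λ f → lower ∘ f ∘ φ←) (λ f → lift ∘ f ∘ φ→)

  ∧-expr : Stable P → Stable Q → Expresses ρ φ P → Expresses ρ ψ Q
         → Expresses ρ (φ ∧ᶠ ψ) (P × Q)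
  ∧-expr sp sq (expresses φ→ φ←) (expresses ψ→ ψ←) = expresses
    (λ h → sp (λ ¬p → lower (h (λ s _ → lift (¬p (φ→ s)))))
         , sq (λ ¬q → lower (h (λ _ s → lift (¬q (ψ→ s))))))
    (λ (x , y) k → k (φ← x) (ψ← y))

  ∨-expr : Expresses ρ φ P → Expresses ρ ψ Q → Expresses ρ (φ ∨ᶠ ψ) (P ∨ Q)
  ∨-expr eφ eψ = ¬-expr (∧-expr negated-stable negated-stable (¬-expr eφ) (¬-expr eψ))

  ⇔-expr : Stable P → Stable Q → Expresses ρ φ P → Expresses ρ ψ Q
         → Expresses ρ (φ ⇔ᶠ ψ) (P ⇔ Q)
  ⇔-expr sp sq eφ eψ = ∧-expr (→-stable sq) (→-stable sp) (⇒-expr eφ eψ) (⇒-expr eψ eφ)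

  ∀-expr : {R : D → Set ℓ} → (∀ d → Expresses (d ∷ ρ) φ (R d))
         → Expresses ρ (∀' φ) (∀ d → R d)
  ∀-expr e = expresses (λ h d → sound (e d) (h d)) (λ h d → complete (e d) (h d))

  ∃-expr : {R : D → Set ℓ} → (∀ d → Expresses (d ∷ ρ) φ (R d))
         → Expresses ρ (∃ᶠ φ) (Ex M R)
  ∃-expr e = ¬-expr (∀-expr (λ d → ¬-expr (e d)))

  Sat-rename : ∀ φ {r ρ σ} → (∀ i → ρ (r i) ≡ σ i) → Expresses ρ (rename r φ) (Sat M σ φ)
  Sat-rename (i ∈' j) h = expresses (subst₂ _∈_ (h i) (h j)) (subst₂ _∈_ (sym (h i)) (sym (h j)))
  Sat-rename (U' i)   h = expresses (subst U (h i)) (subst U (sym (h i)))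
  Sat-rename (i ≐ j)  h = expresses (λ e → trans (sym (h i)) (trans e (h j)))
                                    (λ e → trans (h i) (trans e (sym (h j))))
  Sat-rename ⊥'       h = expresses id id
  Sat-rename (φ ⇒ ψ)  h = ⇒-expr (Sat-rename φ h) (Sat-rename ψ h)
  Sat-rename (∀' φ) {r} {ρ} {σ} h = ∀-expr (λ d → Sat-rename φ (ext-agrees d))
    where
      ext-agrees : ∀ d i → (d ∷ ρ) (ext r i) ≡ (d ∷ σ) i
      ext-agrees d zero    = refl
      ext-agrees d (suc i) = h i

  rename-expr : ∀ {r σ} → (∀ i → ρ (r i) ≡ σ i) → Expresses σ φ P
              → Expresses ρ (rename r φ) P
  rename-expr {φ = φ} h (expresses φ→ φ←) =
    expresses (φ→ ∘ sound (Sat-rename φ h)) (complete (Sat-rename φ h) ∘ φ←)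

module Theory {ℓ : Level} (M : Structure ℓ) (Z : IsZFU M) where
  open Structure M
  open IsZFU Z
  open Semantics M

  private
    variable
      c c' x x' y y' z p p' u v v' s A A' P X Y S α β β' γ F f g : D

  ∈-stable : Stable (x ∈ y)
  ∈-stable = stable-∈ _ _

  ≡-stable : Stable (x ≡ y)
  ≡-stable = stable-≡ _ _

  upair-stable : Stable (IsUPair M p x y)
  upair-stable = ×-stable negated-stable (Π-stable λ _ → ⇔-stable ∈-stable negated-stable)

  upair-expr : ∀ ρ i j k → Expresses ρ (upairᶠ i j k) (IsUPair M (ρ i) (ρ j) (ρ k))
  upair-expr ρ i j k =
    ∧-expr negated-stable (Π-stable λ _ → ⇔-stable ∈-stable negated-stable)
      (¬-expr (U-expr ρ i))
      (∀-expr λ d → ⇔-expr ∈-stable negated-stable (∈-expr (d ∷ ρ) 0 (suc i))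
        (∨-expr (≐-expr (d ∷ ρ) 0 (suc j)) (≐-expr (d ∷ ρ) 0 (suc k))))

  opair-expr : ∀ ρ i j k → Expresses ρ (opairᶠ i j k) (IsOPair M (ρ i) (ρ j) (ρ k))
  opair-expr ρ i j k = ∃-expr λ u → ∃-expr λ v →
    let σ = v ∷ u ∷ ρ in
    ∧-expr upair-stable (×-stable upair-stable upair-stable)
      (upair-expr σ 1 (2 + j) (2 + j))
      (∧-expr upair-stable upair-stable (upair-expr σ 0 (2 + j) (2 + k)) (upair-expr σ (2 + i) 1 0))

  rel-expr : ∀ ρ i j k → Expresses ρ (relᶠ i j k) (Rel M (ρ i) (ρ j) (ρ k))
  rel-expr ρ i j k = ∃-expr λ p →
    ∧-expr ∈-stable negated-stable (∈-expr (p ∷ ρ) 0 (suc i)) (opair-expr (p ∷ ρ) 0 (suc j) (suc k))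

  upair-memberˡ : IsUPair M p x y → x ∈ p
  upair-memberˡ (_ , mem) = proj₂ (mem _) (∨-introˡ refl)

  upair-memberʳ : IsUPair M p x y → y ∈ p
  upair-memberʳ (_ , mem) = proj₂ (mem _) (∨-introʳ refl)

  upair-members : IsUPair M p x y → z ∈ p → (z ≡ x) ∨ (z ≡ y)
  upair-members (_ , mem) = proj₁ (mem _)

  singleton-member : IsUPair M p x x → z ∈ p → z ≡ x
  singleton-member hp zp = ∨-elim ≡-stable (upair-members hp zp) id id

  upair-unique : IsUPair M p x y → IsUPair M p' x y → p ≡ p'
  upair-unique (sp , mem) (sp' , mem') = extensionality _ _ sp sp' λ z →
    proj₂ (mem' z) ∘ proj₁ (mem z) , proj₂ (mem z) ∘ proj₁ (mem' z)

  opair-exists : ∀ x y → Ex M (λ p → IsOPair M p x y)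
  opair-exists x y k =
    pairing x x λ u hu → pairing x y λ v hv → pairing u v λ p hp →
    k p (Ex-intro u (Ex-intro v (hu , hv , hp)))

  opair-elim : Stable C → IsOPair M p x y
             → (∀ u v → IsUPair M u x x → IsUPair M v x y → IsUPair M p u v → C) → C
  opair-elim sc hp k =
    Ex-elim sc hp λ u h → Ex-elim sc h λ v (hu , hv , huv) → k u v hu hv huv

  opair-unique : IsOPair M p x y → IsOPair M p' x y → p ≡ p'
  opair-unique hp hp' =
    opair-elim ≡-stable hp  λ u  v  hu  hv  huv  →
    opair-elim ≡-stable hp' λ u' v' hu' hv' hu'v' →
    upair-unique huv (subst₂ (IsUPair M _) (upair-unique hu' hu) (upair-unique hv' hv) hu'v')

  opair-injectiveˡ : IsOPair M p x y → IsOPair M p x' y' → x ≡ x'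
  opair-injectiveˡ {x = x} {x' = x'} hp hp' =
    opair-elim ≡-stable hp  λ u  v  hu  hv  huv  →
    opair-elim ≡-stable hp' λ u' v' hu' hv' hu'v' →
    ∨-elim ≡-stable (upair-members hu'v' (upair-memberˡ huv))
      (λ u≡u' → singleton-member hu' (subst (x ∈_) u≡u' (upair-memberˡ hu)))
      (λ u≡v' → sym (singleton-member hu (subst (x' ∈_) (sym u≡v') (upair-memberˡ hv'))))

  partner-member : IsUPair M u x x → IsUPair M v x y → IsUPair M p u v
                 → IsUPair M v' x y' → v' ∈ p → y' ∈ v
  partner-member {y' = y'} hu hv huv hv' v'p = ∨-elim ∈-stable (upair-members huv v'p)
    (λ v'≡u → subst (_∈ _) (sym (singleton-member hu (subst (y' ∈_) v'≡u (upair-memberʳ hv'))))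
                    (upair-memberˡ hv))
    (λ v'≡v → subst (y' ∈_) v'≡v (upair-memberʳ hv'))

  opair-injectiveʳ : IsOPair M p x y → IsOPair M p x y' → y ≡ y'
  opair-injectiveʳ hp hp' =
    opair-elim ≡-stable hp  λ u  v  hu  hv  huv  →
    opair-elim ≡-stable hp' λ u' v' hu' hv' hu'v' →
    both-partners
      (upair-members hv' (partner-member hu' hv' hu'v' hv (upair-memberʳ huv)))
      (upair-members hv (partner-member hu hv huv hv' (upair-memberʳ hu'v')))
    where
      both-partners : (y ≡ x) ∨ (y ≡ y') → (y' ≡ x) ∨ (y' ≡ y) → y ≡ y'
      both-partners y∈v' y'∈v = ∨-elim ≡-stable y∈v'
        (λ y≡x → ∨-elim ≡-stable y'∈v (λ y'≡x → trans y≡x (sym y'≡x)) sym)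
        id

  opair-injective : IsOPair M p x y → IsOPair M p x' y' → x ≡ x' × y ≡ y'
  opair-injective hp hp' with opair-injectiveˡ hp hp'
  ... | refl = refl , opair-injectiveʳ hp hp'

  Rel-domain : IsFun M f X Y → Rel M f x y → x ∈ X
  Rel-domain (_ , pairs , _) r =
    Ex-elim ∈-stable r λ p (pf , hp) →
    Ex-elim ∈-stable (pairs p pf) λ x' h → Ex-elim ∈-stable h λ _ (x'X , _ , hp') →
    subst (_∈ _) (opair-injectiveˡ hp' hp) x'X

  Rel-functional : IsFun M f X Y → Rel M f x y → Rel M f x y' → y ≡ y'
  Rel-functional (_ , _ , _ , functional) = functional _ _ _

  product-elim : Stable C → IsProd M F X Y → p ∈ F
               → (∀ x y → x ∈ X → y ∈ Y → IsOPair M p x y → C) → C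
  product-elim sc (_ , mem) pF k =
    Ex-elim sc (proj₁ (mem _) pF) λ x h → Ex-elim sc h λ y (xX , yY , hp) → k x y xX yY hp

  product-intro : IsProd M F X Y → x ∈ X → y ∈ Y → IsOPair M p x y → p ∈ F
  product-intro (_ , mem) xX yY hp = proj₂ (mem _) (Ex-intro _ (Ex-intro _ (xX , yY , hp)))

  ∈-minimal : ∀ φ ρ {R : D → Set ℓ} → (∀ z → Expresses (z ∷ ρ) φ (R z))
            → IsSet M α → β ∈ α → R β
            → Ex M λ μ → μ ∈ α × R μ × (∀ δ → δ ∈ α → δ ∈ μ → ¬ R δ)
  ∈-minimal φ ρ {R} expr sα βα Rβ k =
    separation φ ρ _ sα λ b (sb , mem) →
    foundation b sb (Ex-intro _ (proj₂ (mem _) (βα , complete (expr _) Rβ))) λ μ (μb , μ-min) →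
    let (μα , Sμ) = proj₁ (mem μ) μb in
    k μ (μα , sound (expr μ) Sμ ,
         λ δ δα δμ Rδ → μ-min δ δμ (proj₂ (mem δ) (δα , complete (expr δ) Rδ)))

  Incomparable : D → D → Set ℓ
  Incomparable β γ = ¬ β ∈ γ × ¬ β ≡ γ × ¬ γ ∈ β

  incomparableᶠ : ℕ → ℕ → Fm
  incomparableᶠ i j = ¬ᶠ (i ∈' j) ∧ᶠ ¬ᶠ (i ≐ j) ∧ᶠ ¬ᶠ (j ∈' i)

  incomparable-expr : ∀ ρ i j → Expresses ρ (incomparableᶠ i j) (Incomparable (ρ i) (ρ j))
  incomparable-expr ρ i j =
    ∧-expr negated-stable (×-stable negated-stable negated-stable) (¬-expr (∈-expr ρ i j))
      (∧-expr negated-stable negated-stable (¬-expr (≐-expr ρ i j)) (¬-expr (∈-expr ρ j i)))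

  transitive-sets-comparable :
      IsSet M β → Transitive M β → IsSet M γ → Transitive M γ
    → (∀ δ → δ ∈ β → ¬ Incomparable δ γ) → (∀ δ → δ ∈ γ → ¬ Incomparable β δ)
    → ¬ Incomparable β γ
  transitive-sets-comparable {β} {γ} sβ tβ sγ tγ below-β below-γ (β∉γ , β≢γ , γ∉β) =
    β≢γ (extensionality β γ sβ sγ λ δ → β⊆γ δ , γ⊆β δ)
    where
      β⊆γ : ∀ δ → δ ∈ β → δ ∈ γ
      β⊆γ δ δβ = ∈-stable λ δ∉γ → below-β δ δβ
        (δ∉γ , (λ δ≡γ → γ∉β (subst (_∈ β) δ≡γ δβ)) , (λ γδ → γ∉β (tβ δ γ γδ δβ)))
      γ⊆β : ∀ δ → δ ∈ γ → δ ∈ β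
      γ⊆β δ δγ = ∈-stable λ δ∉β → below-γ δ δγ
        ((λ βδ → β∉γ (tγ δ β βδ δγ)) , (λ β≡δ → β∉γ (subst (_∈ γ) (sym β≡δ) δγ)) , δ∉β)

  -- Take β₀ ∈ α least among members incomparable with some member, then γ₀ ∈ α
  -- least among members incomparable with β₀; minimality makes all members of β₀
  -- and of γ₀ comparable with the other one.
  ordinal-members-comparable : Ordinal M α → β ∈ α → γ ∈ α → ¬ Incomparable β γ
  ordinal-members-comparable {α} (sα , tα , members) βα γα inc =
    Ex-elim ⊥-stable (∈-minimal incomparable-somewhereᶠ (α ∷ const α)
                        incomparable-somewhere-expr sα βα (Ex-intro _ (γα , inc)))
      λ β₀ (β₀α , β₀-inc , β₀-min) →
    Ex-elim ⊥-stable β₀-inc λ γ' (γ'α , inc') →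
    Ex-elim ⊥-stable (∈-minimal (incomparableᶠ 1 0) (β₀ ∷ const β₀)
                        (λ z → incomparable-expr (z ∷ β₀ ∷ const β₀) 1 0) sα γ'α inc')
      λ γ₀ (γ₀α , inc₀ , γ₀-min) →
    let (sβ₀ , tβ₀) = members β₀ β₀α ; (sγ₀ , tγ₀) = members γ₀ γ₀α in
    transitive-sets-comparable sβ₀ tβ₀ sγ₀ tγ₀
      (λ δ δβ₀ incδ → β₀-min δ (tα β₀ δ δβ₀ β₀α) δβ₀ (Ex-intro γ₀ (γ₀α , incδ)))
      (λ δ δγ₀ → γ₀-min δ (tα γ₀ δ δγ₀ γ₀α) δγ₀)
      inc₀
    where
      incomparable-somewhereᶠ : Fm
      incomparable-somewhereᶠ = ∃ᶠ ((0 ∈' 2) ∧ᶠ incomparableᶠ 1 0)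
      incomparable-somewhere-expr : ∀ z → Expresses (z ∷ α ∷ const α) incomparable-somewhereᶠ
                                                    (Ex M λ δ → δ ∈ α × Incomparable z δ)
      incomparable-somewhere-expr z = ∃-expr λ δ →
        ∧-expr ∈-stable (×-stable negated-stable (×-stable negated-stable negated-stable))
          (∈-expr (δ ∷ z ∷ α ∷ const α) 0 2) (incomparable-expr (δ ∷ z ∷ α ∷ const α) 1 0)

  module _ (θ : Fm) (ρ : ℕ → D) {T : D → D → Set ℓ}
           (θ-expr : ∀ y c → Expresses (c ∷ y ∷ ρ) θ (T y c))
           (T-stable : ∀ {y c} → Stable (T y c)) where

    GraphPoint : D → D → Set ℓ
    GraphPoint y p = Ex M λ c → IsOPair M p y c × T y c

    IsGraph : D → D → Set ℓ
    IsGraph x f = IsSet M f × (∀ p → p ∈ f ⇔ Ex M (λ y → y ∈ x × GraphPoint y p))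

    graphPointᶠ : Fm
    graphPointᶠ = ∃ᶠ (opairᶠ 1 2 0 ∧ᶠ rename skip-1 θ)
      where
        skip-1 : ℕ → ℕ
        skip-1 zero    = zero
        skip-1 (suc i) = suc (suc i)

    graphPoint-expr : ∀ y p → Expresses (p ∷ y ∷ ρ) graphPointᶠ (GraphPoint y p)
    graphPoint-expr y p = ∃-expr λ c →
      ∧-expr negated-stable T-stable (opair-expr (c ∷ p ∷ y ∷ ρ) 1 2 0)
        (rename-expr (λ { zero → refl ; (suc i) → refl }) (θ-expr y c))

    module _ {x : D}
             (unique : ∀ {y c c'} → y ∈ x → T y c → T y c' → c ≡ c') where

      graphPoint-unique : y ∈ x → GraphPoint y p → GraphPoint y p' → p ≡ p'
      graphPoint-unique yx hp hp' =
        Ex-elim ≡-stable hp  λ c  (hc  , Tc)  →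
        Ex-elim ≡-stable hp' λ c' (hc' , Tc') →
        opair-unique hc (subst (IsOPair M _ _) (sym (unique yx Tc Tc')) hc')

      graph-exists : (∀ y → y ∈ x → Ex M (T y)) → Ex M (IsGraph x)
      graph-exists total k =
        replacement graphPointᶠ ρ x point-exists λ b (sb , b-covers) →
        separation memberᶠ (x ∷ ρ) b sb λ f (sf , f-mem) →
        k f (sf , λ p → (λ pf → sound (member-expr p) (proj₂ (proj₁ (f-mem p) pf)))
                      , (λ e → proj₂ (f-mem p) (covered b-covers e , complete (member-expr p) e)))
        where
          point-exists : ∀ y → y ∈ x
                       → Ex M (λ p₀ → ∀ p → Sat M (p ∷ y ∷ ρ) graphPointᶠ ⇔ (p ≡ p₀))
          point-exists y yx =
            Ex-elim negated-stable (total y yx) λ c Tc →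
            Ex-elim negated-stable (opair-exists y c) λ p₀ hp₀ →
            let pt₀ = Ex-intro c (hp₀ , Tc) in
            Ex-intro p₀ λ p →
              (λ s → graphPoint-unique yx (sound (graphPoint-expr y p) s) pt₀)
            , (λ { refl → complete (graphPoint-expr y p) pt₀ })

          covered : ∀ {b p} → (∀ y → y ∈ x → Ex M (λ p → p ∈ b × Sat M (p ∷ y ∷ ρ) graphPointᶠ))
                  → Ex M (λ y → y ∈ x × GraphPoint y p) → p ∈ b
          covered {b} b-covers e =
            Ex-elim ∈-stable e λ y (yx , pt) →
            Ex-elim ∈-stable (b-covers y yx) λ p' (p'b , sat) →
            subst (_∈ b) (graphPoint-unique yx (sound (graphPoint-expr y p') sat) pt) p'b

          memberᶠ : Fm
          memberᶠ = ∃ᶠ ((0 ∈' 2) ∧ᶠ rename swap-01 graphPointᶠ)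
            where
              swap-01 : ℕ → ℕ
              swap-01 zero          = 1
              swap-01 (suc zero)    = 0
              swap-01 (suc (suc i)) = 3 + i

          member-expr : ∀ p → Expresses (p ∷ x ∷ ρ) memberᶠ (Ex M λ y → y ∈ x × GraphPoint y p)
          member-expr p = ∃-expr λ y →
            ∧-expr ∈-stable negated-stable (∈-expr (y ∷ p ∷ x ∷ ρ) 0 2)
              (rename-expr (λ { zero → refl ; (suc zero) → refl ; (suc (suc i)) → refl })
                 (graphPoint-expr y p))

      graph-Rel-sound : IsGraph x f → Rel M f y c → y ∈ x × T y c
      graph-Rel-sound (_ , mem) r =
        Ex-elim (×-stable ∈-stable T-stable) r λ p (pf , hp) →
        Ex-elim (×-stable ∈-stable T-stable) (proj₁ (mem p) pf) λ y' (y'x , pt) →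
        Ex-elim (×-stable ∈-stable T-stable) pt λ c' (hp' , Tc') →
        let (y'≡y , c'≡c) = opair-injective hp' hp in
        subst (_∈ _) y'≡y y'x , subst₂ T y'≡y c'≡c Tc'

      graph-Rel-complete : IsGraph x f → y ∈ x → T y c → Rel M f y c
      graph-Rel-complete (_ , mem) yx Tc =
        Ex-elim negated-stable (opair-exists _ _) λ p hp →
        Ex-intro p (proj₂ (mem p) (Ex-intro _ (yx , Ex-intro _ (hp , Tc))) , hp)

      graph-function : ∀ {Y} → IsGraph x f
        → (∀ y → y ∈ x → Ex M (T y)) → (∀ {y c} → y ∈ x → T y c → c ∈ Y)
        → IsFun M f x Y
      graph-function graph@(sf , mem) total into =
          sf
        , (λ p pf → Ex-elim negated-stable (proj₁ (mem p) pf) λ y (yx , pt) →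
             Ex-elim negated-stable pt λ c (hp , Tc) →
             Ex-intro y (Ex-intro c (yx , into yx Tc , hp)))
        , (λ y yx → Ex-elim negated-stable (total y yx) λ c Tc →
             Ex-intro c (graph-Rel-complete graph yx Tc))
        , (λ y c c' r r' →
             let (yx , Tc) = graph-Rel-sound graph r ; (_ , Tc') = graph-Rel-sound graph r'
             in unique yx Tc Tc')

      graph-injective : IsGraph x f
        → (∀ {y y' c} → y ∈ x → y' ∈ x → T y c → T y' c → y ≡ y')
        → IsInj M f
      graph-injective graph injective y y' c r r' =
        let (yx , Tc) = graph-Rel-sound graph r ; (y'x , Ty'c) = graph-Rel-sound graph r'
        in injective yx y'x Tc Ty'c

      definable-injection : ∀ {Y}
        → (∀ y → y ∈ x → Ex M (T y))
        → (∀ {y c} → y ∈ x → T y c → c ∈ Y)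
        → (∀ {y y' c} → y ∈ x → y' ∈ x → T y c → T y' c → y ≡ y')
        → _≼_ M x Y
      definable-injection total into injective =
        Ex-elim negated-stable (graph-exists total) λ f graph →
        Ex-intro f (graph-function graph total into , graph-injective graph injective)

  Sends : D → D → D → D → Set ℓ
  Sends g s β y = Ex M λ q → IsOPair M q s β × Rel M g q y

  sendsᶠ : ℕ → ℕ → ℕ → ℕ → Fm
  sendsᶠ g s β y = ∃ᶠ (opairᶠ 0 (suc s) (suc β) ∧ᶠ relᶠ (suc g) 0 (suc y))

  sends-expr : ∀ ρ g s β y → Expresses ρ (sendsᶠ g s β y) (Sends (ρ g) (ρ s) (ρ β) (ρ y))
  sends-expr ρ g s β y = ∃-expr λ q →
    ∧-expr negated-stable negated-stable
      (opair-expr (q ∷ ρ) 0 (suc s) (suc β)) (rel-expr (q ∷ ρ) (suc g) 0 (suc y))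

  Sends-functional : IsFun M g X x → Sends g s β y → Sends g s β y' → y ≡ y'
  Sends-functional {g = g} gfun h h' =
    Ex-elim ≡-stable h  λ q  (hq  , r)  →
    Ex-elim ≡-stable h' λ q' (hq' , r') →
    Rel-functional gfun r (subst (λ w → Rel M g w _) (opair-unique hq' hq) r')

  Attained : D → D → D → D → Set ℓ
  Attained g S y β = Ex M λ s → s ∈ S × Sends g s β y

  attainedᶠ : ℕ → ℕ → ℕ → ℕ → Fm
  attainedᶠ g S y β = ∃ᶠ ((0 ∈' suc S) ∧ᶠ sendsᶠ (suc g) 0 (suc β) (suc y))

  attained-expr : ∀ ρ g S y β → Expresses ρ (attainedᶠ g S y β) (Attained (ρ g) (ρ S) (ρ y) (ρ β))
  attained-expr ρ g S y β = ∃-expr λ s →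
    ∧-expr ∈-stable negated-stable
      (∈-expr (s ∷ ρ) 0 (suc S)) (sends-expr (s ∷ ρ) (suc g) 0 (suc β) (suc y))

  LeastLevel : D → D → D → D → D → Set ℓ
  LeastLevel g S α y β = β ∈ α × Attained g S y β × (∀ γ → γ ∈ β → ¬ Attained g S y γ)

  leastLevelᶠ : ℕ → ℕ → ℕ → ℕ → ℕ → Fm
  leastLevelᶠ g S α y β =
    (β ∈' α) ∧ᶠ attainedᶠ g S y β ∧ᶠ ∀' ((0 ∈' suc β) ⇒ ¬ᶠ attainedᶠ (suc g) (suc S) (suc y) 0)

  leastLevel-stable : Stable (LeastLevel g S α y β)
  leastLevel-stable =
    ×-stable ∈-stable (×-stable negated-stable (Π-stable λ _ → →-stable negated-stable))

  leastLevel-expr : ∀ ρ g S α y β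
    → Expresses ρ (leastLevelᶠ g S α y β) (LeastLevel (ρ g) (ρ S) (ρ α) (ρ y) (ρ β))
  leastLevel-expr ρ g S α y β =
    ∧-expr ∈-stable (×-stable negated-stable (Π-stable λ _ → →-stable negated-stable))
      (∈-expr ρ β α)
      (∧-expr negated-stable (Π-stable λ _ → →-stable negated-stable)
        (attained-expr ρ g S y β)
        (∀-expr λ γ → ⇒-expr (∈-expr (γ ∷ ρ) 0 (suc β))
                             (¬-expr (attained-expr (γ ∷ ρ) (suc g) (suc S) (suc y) 0))))

  leastLevel-exists : Ordinal M α → β ∈ α → Attained g S y β → Ex M (LeastLevel g S α y)
  leastLevel-exists {α} {β} {g} {S} {y} (sα , tα , _) βα attained =
    Ex-elim negated-stable
      (∈-minimal (attainedᶠ 1 2 3 0) ρ (λ z → attained-expr (z ∷ ρ) 1 2 3 0) sα βα attained)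
      λ μ (μα , attainedμ , μ-min) →
    Ex-intro μ (μα , attainedμ , λ γ γμ → μ-min γ (tα μ γ γμ μα) γμ)
    where
      ρ : ℕ → D
      ρ = g ∷ S ∷ y ∷ const g

  leastLevel-unique : Ordinal M α → LeastLevel g S α y β → LeastLevel g S α y β' → β ≡ β'
  leastLevel-unique hα (βα , attained , β-min) (β'α , attained' , β'-min) = ≡-stable λ β≢β' →
    ordinal-members-comparable hα βα β'α
      ((λ ββ' → β'-min _ ββ' attained) , β≢β' , (λ β'β → β-min _ β'β attained'))

  Fibre : D → D → D → D → D → Set ℓ
  Fibre g S A y β = IsSet M A × (∀ s → s ∈ A ⇔ (s ∈ S × Sends g s β y))

  fibreᶠ : ℕ → ℕ → ℕ → ℕ → ℕ → Fm
  fibreᶠ g S A y β =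
    ¬ᶠ U' A ∧ᶠ ∀' ((0 ∈' suc A) ⇔ᶠ ((0 ∈' suc S) ∧ᶠ sendsᶠ (suc g) 0 (suc β) (suc y)))

  fibre-stable : Stable (Fibre g S A y β)
  fibre-stable =
    ×-stable negated-stable (Π-stable λ _ → ⇔-stable ∈-stable (×-stable ∈-stable negated-stable))

  fibre-expr : ∀ ρ g S A y β
    → Expresses ρ (fibreᶠ g S A y β) (Fibre (ρ g) (ρ S) (ρ A) (ρ y) (ρ β))
  fibre-expr ρ g S A y β =
    ∧-expr negated-stable (Π-stable λ _ → ⇔-stable ∈-stable (×-stable ∈-stable negated-stable))
      (¬-expr (U-expr ρ A))
      (∀-expr λ s → ⇔-expr ∈-stable (×-stable ∈-stable negated-stable) (∈-expr (s ∷ ρ) 0 (suc A))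
        (∧-expr ∈-stable negated-stable
          (∈-expr (s ∷ ρ) 0 (suc S)) (sends-expr (s ∷ ρ) (suc g) 0 (suc β) (suc y))))

  fibre-exists : IsSet M S → Ex M (λ A → Fibre g S A y β)
  fibre-exists {S} {g} {y} {β} sS k =
    separation (sendsᶠ 1 0 2 3) ρ S sS λ A (sA , mem) →
    k A (sA , λ s → (λ sA → let (sS , sat) = proj₁ (mem s) sA in sS , sound (expr s) sat)
                  , (λ (sS , sends) → proj₂ (mem s) (sS , complete (expr s) sends)))
    where
      ρ : ℕ → D
      ρ = g ∷ β ∷ y ∷ const g
      expr : ∀ s → Expresses (s ∷ ρ) (sendsᶠ 1 0 2 3) (Sends g s β y)
      expr s = sends-expr (s ∷ ρ) 1 0 2 3

  fibre-unique : Fibre g S A y β → Fibre g S A' y β → A ≡ A'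
  fibre-unique (sA , mem) (sA' , mem') = extensionality _ _ sA sA' λ s →
    proj₂ (mem' s) ∘ proj₁ (mem s) , proj₂ (mem s) ∘ proj₁ (mem' s)

  Code : D → D → D → D → D → Set ℓ
  Code g S α y c = Ex M λ A → Ex M λ β → IsOPair M c A β × LeastLevel g S α y β × Fibre g S A y β

  codeᶠ : Fm
  codeᶠ = ∃ᶠ (∃ᶠ (opairᶠ 2 1 0 ∧ᶠ leastLevelᶠ 4 5 6 3 0 ∧ᶠ fibreᶠ 4 5 1 3 0))

  code-expr : ∀ ρ g S α y c → Expresses (c ∷ y ∷ g ∷ S ∷ α ∷ ρ) codeᶠ (Code g S α y c)
  code-expr ρ g S α y c = ∃-expr λ A → ∃-expr λ β →
    let σ = β ∷ A ∷ c ∷ y ∷ g ∷ S ∷ α ∷ ρ in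
    ∧-expr negated-stable (×-stable leastLevel-stable fibre-stable) (opair-expr σ 2 1 0)
      (∧-expr leastLevel-stable fibre-stable (leastLevel-expr σ 4 5 6 3 0) (fibre-expr σ 4 5 1 3 0))

  code-elim : Stable C → Code g S α y c
            → (∀ A β → IsOPair M c A β → LeastLevel g S α y β → Fibre g S A y β → C) → C
  code-elim sc h k =
    Ex-elim sc h λ A h' → Ex-elim sc h' λ β (hc , least , fibre) → k A β hc least fibre

  code-exists : Ordinal M α → IsProd M X S α → IsSet M S → IsFun M g X x → IsSurjOnto M g x
              → y ∈ x → Ex M (Code g S α y)
  code-exists hα hX sS gfun gsurj yx =
    Ex-elim negated-stable (gsurj _ yx) λ q r →
    product-elim negated-stable hX (Rel-domain gfun r) λ s₀ β₀ s₀S β₀α hq →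
    Ex-elim negated-stable (leastLevel-exists hα β₀α (Ex-intro s₀ (s₀S , Ex-intro q (hq , r))))
      λ β least →
    Ex-elim negated-stable (fibre-exists sS) λ A fibre →
    Ex-elim negated-stable (opair-exists A β) λ c hc →
    Ex-intro c (Ex-intro A (Ex-intro β (hc , least , fibre)))

  code-unique : Ordinal M α → Code g S α y c → Code g S α y c' → c ≡ c'
  code-unique {c' = c'} hα h h' =
    code-elim ≡-stable h  λ A  β  hc  least  fibre  →
    code-elim ≡-stable h' λ A' β' hc' least' fibre' →
    let β≡β' = leastLevel-unique hα least least'
        A≡A' = fibre-unique fibre (subst (Fibre _ _ A' _) (sym β≡β') fibre')
    in opair-unique hc (subst₂ (IsOPair M c') (sym A≡A') (sym β≡β') hc')

  -- The fibre is nonempty, so a common code pins down a common value of g.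
  code-injective : IsFun M g X x → Code g S α y c → Code g S α y' c → y ≡ y'
  code-injective {y' = y'} gfun h h' =
    code-elim ≡-stable h  λ A  β  hc  (_ , attained , _) fibre →
    code-elim ≡-stable h' λ A' β' hc' _                  fibre' →
    let (A≡A' , β≡β') = opair-injective hc hc' in
    Ex-elim ≡-stable attained λ s (sS , sends) →
    let sA' = subst (s ∈_) A≡A' (proj₂ (proj₂ fibre s) (sS , sends))
        sends' = proj₂ (proj₁ (proj₂ fibre' s) sA')
    in Sends-functional gfun sends (subst (λ γ → Sends _ s γ y') (sym β≡β') sends')

  code-member : IsPow M P S → IsProd M Y P α → Code g S α y c → c ∈ Y
  code-member (_ , pow) hY h =
    code-elim ∈-stable h λ A β hc (βα , _) (sA , mem) →
    product-intro hY (proj₂ (pow A) (sA , λ s → proj₁ ∘ proj₁ (mem s))) βα hc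

  surjection-≼-power×ordinal :
      Ordinal M α → IsProd M X S α → IsSet M S → IsPow M P S → IsProd M Y P α
    → IsFun M g X x → IsSurjOnto M g x → _≼_ M x Y
  surjection-≼-power×ordinal {α} {S = S} {g = g} hα hX sS hP hY gfun gsurj =
    definable-injection codeᶠ (g ∷ S ∷ α ∷ const g) (code-expr (const g) g S α) negated-stable
      (λ _ → code-unique hα)
      (λ y yx → code-exists hα hX sS gfun gsurj yx)
      (λ _ → code-member hP hY)
      (λ _ _ → code-injective gfun)

  empty-≼ : IsSet M x → IsEmpty M x → _≼_ M x Y
  empty-≼ {x} sx (_ , empty) = Ex-intro x
    ( (sx , (λ p px → ⊥-elim (empty p px)) , (λ a ax → ⊥-elim (empty a ax))
          , λ _ _ _ r _ → ⊥-elim (no-rel r))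
    , λ _ _ _ r _ → ⊥-elim (no-rel r))
    where
      no-rel : ∀ {a b} → ¬ Rel M x a b
      no-rel r = Ex-elim ⊥-stable r λ p (px , _) → empty p px

proposition2p13 : ∀ {ℓ : Level} (M : Structure ℓ) → IsZFU M
    → ∀ x S α X P Y
    → IsSet M x → IsSet M S → Ordinal M α
    → IsProd M X S α → IsPow M P S → IsProd M Y P α
    → _≼*_ M x X → _≼_ M x Y
proposition2p13 M Z x S α X P Y sx sS hα hX hP hY x≼*X =
  ∨-elim negated-stable x≼*X
    (λ surjection → Ex-elim negated-stable surjection λ g (gfun , gsurj) →
       surjection-≼-power×ordinal hα hX sS hP hY gfun gsurj)
    (empty-≼ sx)
  where
    open Semantics M
    open Theory M Z
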